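{- Let $n>1$ be an integer and let $m_1,m_2,\ldots,m_{n-1}$ be integers such that $$\big|\{1\le s<n:\ d\nmid m_s\}\big|\ \ge\ d-1\quad\text{for every positive divisor } d \text{ of } n.$$ Then the set $$\Big\{\sum_{i\in I}m_i:\ I\subseteq\{1,\ldots,n-1\}\Big\}$$ contains a complete system of residues modulo $n$.
   Context: The empty subset $I$ gives the sum $0$. -}

module Defs where

open import Data.Nat as ℕ using (ℕ; _∸_)
open import Data.Nat.Divisibility as ℕD using ()
open import Data.Integer as ℤ using (ℤ; +_; _-_)
open import Data.Integer.Divisibility using (_∣_)
open import Data.Fin using (Fin)
open import Data.Bool using (Bool; true; false)
open import Data.Vec using (Vec; []; _∷_)
open import Data.List using (List; length; filter; allFin)
open import Relation.Nullary.Decidable using (¬?)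

nonDivCount : ∀ {k} → ℕ → (Fin k → ℤ) → ℕ
nonDivCount {k} d m = length (filter (λ s → ¬? (d ℕD.∣? ℤ.∣ m s ∣)) (allFin k))

-- Subset sum: I is a subset of the index set given as a characteristic vector.
subsetSum : ∀ {k} → Vec Bool k → (Fin k → ℤ) → ℤ
subsetSum [] m = + 0
subsetSum (true ∷ I) m = m Data.Fin.zero ℤ.+ subsetSum I (λ s → m (Data.Fin.suc s))
subsetSum (false ∷ I) m = subsetSum I (λ s → m (Data.Fin.suc s))

-- Strong induction on n, proved for an arbitrary index set J₀ in place of {1, …, n-1}. Starting
-- from J = ∅, enlarge J ⊆ J₀ one index at a time, keeping more residues mod n representable by
-- subset sums of J than J has elements: i ∈ J₀ ∖ J is added whenever shifting some representable
-- residue by m_i leaves the representable set. Once no such index exists, the representable set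
-- is invariant under every m_i with i ∈ J₀ ∖ J, hence under g = gcd(n, m_i : i ∈ J₀ ∖ J). If
-- g < n, the discarded m_i are divisible by every divisor of g, so the hypothesis for the divisors
-- of g holds for J itself; by induction every residue mod g is a subset sum of J, and invariance
-- under g lifts this to every residue mod n. If g = n, the hypothesis for d = n gives |J| ≥ n - 1,
-- so at least n, i.e. all, residues are representable.
module Submission where

open import Defs
open import Data.Nat as ℕ using (ℕ; _∸_; _<_; _≥_; NonZero)
open import Data.Nat.Divisibility as ℕD using ()
open import Data.Integer as ℤ using (ℤ; +_; _-_)
open import Data.Integer.Divisibility using (_∣_)
open import Data.Fin using (Fin)
open import Data.Bool using (Bool)
open import Data.Vec using (Vec)
open import Data.Product using (∃)

open import Data.Bool using (true; false)
open import Data.Fin using (zero; suc; toℕ; fromℕ<)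
open import Data.Fin.Properties using (toℕ-fromℕ<; any?)
open import Data.Fin.Subset
  using (Subset; inside; outside; ⊥; ⊤; ⁅_⁆; _∈_; _∉_; _⊆_; _∪_; _∩_; ∁; ∣_∣)
open import Data.Fin.Subset.Properties
  using (_∈?_; _⊆?_; anySubset?; ⊥⊆; ∉⊥; ∈⊤; ∣⊥∣≡0; ∣p∣≤n; ∣p∣≡n⇒p≡⊤; p⊆q⇒∣p∣≤∣q∣; p⊂q⇒∣p∣<∣q∣;
         x∈⁅y⁆⇒x≡y; ∪-identityʳ; p⊆p∪q; x∈p∪q⁺; x∈p∪q⁻; ∩-identityˡ; x∈p∩q⁺; x∈p∩q⁻; ∣p∩q∣≤∣p∣;
         x∈∁p⇒x∉p; x∉p⇒x∈∁p)
open import Data.Integer using (0ℤ; 1ℤ; _+_; _*_; -_)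
import Data.Integer.Properties as ℤP
open import Data.Integer.DivMod using (_%ℕ_; _/ℕ_; n%ℕd<d; a≡a%ℕn+[a/ℕn]*n)
open import Data.Integer.Divisibility.Signed using (divides) renaming (_∣_ to _∣ₛ_)
import Data.Integer.Divisibility.Signed as ℤD
open import Data.Integer.Tactic.RingSolver using (solve-∀)
open import Data.List using (length; filter)
import Data.List as List
open import Data.Nat using (zero; suc; s≤s; _≤_)
open import Data.Nat.GCD using (gcd; gcd-GCD; gcd[m,n]∣m; gcd[m,n]∣n; module Bézout)
open import Data.Nat.Induction using (<-rec)
import Data.Nat.Properties as ℕP
open import Data.Product using (_×_; _,_; proj₁; proj₂; map₂)
open import Data.Sum using (inj₁; inj₂)
open import Data.Vec using ([]; _∷_; here; there; tabulate)
open import Data.Vec.Properties using (lookup∘tabulate; lookup⇒[]=; []=⇒lookup)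
open import Function using (_∘_; id)
open import Relation.Binary.PropositionalEquality
open import Relation.Nullary using (Dec; yes; no; does; ¬_; contradiction)
open import Relation.Nullary.Decidable using (dec-true; decidable-stable; ¬?; _×-dec_)
open import Relation.Unary using (Decidable)

∣-diff-comm : ∀ {d x y} → d ∣ₛ x - y → d ∣ₛ y - x
∣-diff-comm {x = x} {y} d∣x-y = subst (_ ∣ₛ_) (negate x y) (ℤD.∣m⇒∣-m d∣x-y)
  where
  negate : ∀ x y → - (x - y) ≡ y - x
  negate = solve-∀

subset : ∀ {k} {P : Fin k → Set} → Decidable P → Subset k
subset P? = tabulate (does ∘ P?)

module _ {k} {P : Fin k → Set} (P? : Decidable P) where

  ∈-subset⁺ : ∀ {i} → P i → i ∈ subset P?
  ∈-subset⁺ {i} pi = lookup⇒[]= i _ (trans (lookup∘tabulate (does ∘ P?) i) (dec-true (P? i) pi))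

  ∈-subset⁻ : ∀ {i} → i ∈ subset P? → P i
  ∈-subset⁻ {i} i∈ with P? i | trans (sym (lookup∘tabulate (does ∘ P?) i)) ([]=⇒lookup i∈)
  ... | yes pi | _ = pi

x∈p∩∁q⁻ : ∀ {k} (p q : Subset k) {x} → x ∈ p ∩ ∁ q → x ∈ p × x ∉ q
x∈p∩∁q⁻ p q x∈ = let x∈p , x∈∁q = x∈p∩q⁻ p (∁ q) x∈ in x∈p , x∈∁p⇒x∉p x∈∁q

∪⁅⁆-⊆ : ∀ {k} {p q : Subset k} {x} → p ⊆ q → x ∈ q → p ∪ ⁅ x ⁆ ⊆ q
∪⁅⁆-⊆ {p = p} {x = x} p⊆q x∈q y∈ with x∈p∪q⁻ p ⁅ x ⁆ y∈
... | inj₁ y∈p   = p⊆q y∈p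
... | inj₂ y∈⁅x⁆ = subst (_∈ _) (sym (x∈⁅y⁆⇒x≡y x y∈⁅x⁆)) x∈q

∪-monoˡ-⊆ : ∀ {k} {p q : Subset k} (r : Subset k) → p ⊆ q → p ∪ r ⊆ q ∪ r
∪-monoˡ-⊆ {p = p} r p⊆q x∈ with x∈p∪q⁻ p r x∈
... | inj₁ x∈p = x∈p∪q⁺ (inj₁ (p⊆q x∈p))
... | inj₂ x∈r = x∈p∪q⁺ (inj₂ x∈r)

∣p∪⁅x⁆∣≡1+∣p∣ : ∀ {k} (p : Subset k) {x} → x ∉ p → ∣ p ∪ ⁅ x ⁆ ∣ ≡ suc ∣ p ∣
∣p∪⁅x⁆∣≡1+∣p∣ (inside ∷ p)  {zero}  x∉p = contradiction here x∉p
∣p∪⁅x⁆∣≡1+∣p∣ (outside ∷ p) {zero}  _   = cong (λ q → suc ∣ q ∣) (∪-identityʳ p)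
∣p∪⁅x⁆∣≡1+∣p∣ (inside ∷ p)  {suc x} x∉p = cong suc (∣p∪⁅x⁆∣≡1+∣p∣ p (x∉p ∘ there))
∣p∪⁅x⁆∣≡1+∣p∣ (outside ∷ p) {suc x} x∉p = ∣p∪⁅x⁆∣≡1+∣p∣ p (x∉p ∘ there)

x∉p⇒∣p∣<n : ∀ {k} (p : Subset k) {x} → x ∉ p → ∣ p ∣ < k
x∉p⇒∣p∣<n p {x} x∉p = subst (_≤ _) (∣p∪⁅x⁆∣≡1+∣p∣ p x∉p) (∣p∣≤n (p ∪ ⁅ x ⁆))

∣p∩r∣≤∣q∩r∣ : ∀ {k} (p q r : Subset k) → (∀ {x} → x ∈ p ∩ ∁ q → x ∉ r) → ∣ p ∩ r ∣ ≤ ∣ q ∩ r ∣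
∣p∩r∣≤∣q∩r∣ p q r p∖q∩r≡∅ = p⊆q⇒∣p∣≤∣q∣ λ {x} x∈p∩r →
  let x∈p , x∈r = x∈p∩q⁻ p r x∈p∩r
      x∈q = decidable-stable (x ∈? q) λ x∉q → p∖q∩r≡∅ (x∈p∩q⁺ (x∈p , x∉p⇒x∈∁p x∉q)) x∈r
  in x∈p∩q⁺ (x∈q , x∈r)

length-filter-tabulate : ∀ {k} {A : Set} {P : A → Set} (P? : Decidable P) (f : Fin k → A) →
                         length (filter P? (List.tabulate f)) ≡ ∣ subset (P? ∘ f) ∣
length-filter-tabulate {zero}  P? f = refl
length-filter-tabulate {suc k} P? f with does (P? (f zero))
... | true  = cong suc (length-filter-tabulate P? (f ∘ suc))
... | false = length-filter-tabulate P? (f ∘ suc)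

subsetSum-⊥ : ∀ {k} (m : Fin k → ℤ) → subsetSum ⊥ m ≡ 0ℤ
subsetSum-⊥ {zero}  m = refl
subsetSum-⊥ {suc k} m = subsetSum-⊥ (m ∘ suc)

subsetSum-∪⁅⁆ : ∀ {k} (I : Subset k) (m : Fin k → ℤ) {i} → i ∉ I →
                subsetSum (I ∪ ⁅ i ⁆) m ≡ subsetSum I m + m i
subsetSum-∪⁅⁆ (inside ∷ I)  m {zero} i∉I = contradiction here i∉I
subsetSum-∪⁅⁆ (outside ∷ I) m {zero} _   = begin
  m zero + subsetSum (I ∪ ⊥) (m ∘ suc)  ≡⟨ cong (λ J → m zero + subsetSum J (m ∘ suc)) (∪-identityʳ I) ⟩
  m zero + subsetSum I (m ∘ suc)        ≡⟨ ℤP.+-comm (m zero) _ ⟩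
  subsetSum I (m ∘ suc) + m zero        ∎
  where open ≡-Reasoning
subsetSum-∪⁅⁆ (inside ∷ I)  m {suc i} i∉I = begin
  m zero + subsetSum (I ∪ ⁅ i ⁆) (m ∘ suc)      ≡⟨ cong (_+_ (m zero)) (subsetSum-∪⁅⁆ I (m ∘ suc) (i∉I ∘ there)) ⟩
  m zero + (subsetSum I (m ∘ suc) + m (suc i))  ≡⟨ ℤP.+-assoc (m zero) _ _ ⟨
  m zero + subsetSum I (m ∘ suc) + m (suc i)    ∎
  where open ≡-Reasoning
subsetSum-∪⁅⁆ (outside ∷ I) m {suc i} i∉I = subsetSum-∪⁅⁆ I (m ∘ suc) (i∉I ∘ there)

gcdOver : ∀ {k} → Subset k → (Fin k → ℕ) → ℕ → ℕ
gcdOver []            v g = g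
gcdOver (inside ∷ R)  v g = gcd (v zero) (gcdOver R (v ∘ suc) g)
gcdOver (outside ∷ R) v g = gcdOver R (v ∘ suc) g

gcdOver∣base : ∀ {k} (R : Subset k) v g → gcdOver R v g ℕD.∣ g
gcdOver∣base []            v g = ℕD.∣-refl
gcdOver∣base (inside ∷ R)  v g = ℕD.∣-trans (gcd[m,n]∣n (v zero) _) (gcdOver∣base R (v ∘ suc) g)
gcdOver∣base (outside ∷ R) v g = gcdOver∣base R (v ∘ suc) g

gcdOver∣elem : ∀ {k} (R : Subset k) v g {i} → i ∈ R → gcdOver R v g ℕD.∣ v i
gcdOver∣elem (inside ∷ R)  v g here        = gcd[m,n]∣m (v zero) _
gcdOver∣elem (inside ∷ R)  v g (there i∈R) =
  ℕD.∣-trans (gcd[m,n]∣n (v zero) _) (gcdOver∣elem R (v ∘ suc) g i∈R)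
gcdOver∣elem (outside ∷ R) v g (there i∈R) = gcdOver∣elem R (v ∘ suc) g i∈R

gcdOver-closed : ∀ {k} (Q : ℕ → Set) → (∀ {a b} → Q a → Q b → Q (gcd a b)) →
                 (R : Subset k) (v : Fin k → ℕ) {g : ℕ} →
                 (∀ {i} → i ∈ R → Q (v i)) → Q g → Q (gcdOver R v g)
gcdOver-closed Q gcd-closed []            v qv qg = qg
gcdOver-closed Q gcd-closed (inside ∷ R)  v qv qg =
  gcd-closed (qv here) (gcdOver-closed Q gcd-closed R (v ∘ suc) (qv ∘ there) qg)
gcdOver-closed Q gcd-closed (outside ∷ R) v qv qg =
  gcdOver-closed Q gcd-closed R (v ∘ suc) (qv ∘ there) qg

record Period (P : ℤ → Set) (t : ℤ) : Set where
  constructor period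
  field shift : ∀ {z} → P z → P (z + t)
open Period

module _ {P : ℤ → Set} where

  period-+ : ∀ {s t} → Period P s → Period P t → Period P (s + t)
  period-+ {s} {t} ps pt = period λ {z} pz → subst P (ℤP.+-assoc z s t) (shift pt (shift ps pz))

  period-*ℕ : ∀ {t} → Period P t → ∀ j → Period P (+ j * t)
  period-*ℕ {t} pt zero = period λ {z} →
    subst P (sym (trans (cong (_+_ z) (ℤP.*-zeroˡ t)) (ℤP.+-identityʳ z)))
  period-*ℕ {t} pt (suc j) =
    subst (Period P) (sym (ℤP.suc-* (+ j) t)) (period-+ pt (period-*ℕ pt j))

module _ {n : ℕ} .{{_ : NonZero n}} {P : ℤ → Set}
         (P-resp : ∀ {x y} → + n ∣ₛ x - y → P x → P y) where

  period-n : Period P (+ n)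
  period-n = period λ {z} → P-resp (divides (- 1ℤ) (shift-back z (+ n)))
    where
    shift-back : ∀ z t → z - (z + t) ≡ - 1ℤ * t
    shift-back = solve-∀

  -- -t ≡ (n - 1) t modulo n.
  period-neg : ∀ {t} → Period P t → Period P (- t)
  period-neg {t} pt = period λ {z} pz → P-resp (divides t (difference z)) (shift (period-*ℕ pt (n ∸ 1)) pz)
    where
    expand : ∀ z p t → (z + p * t) - (z + - t) ≡ (1ℤ + p) * t
    expand = solve-∀
    difference : ∀ z → (z + + (n ∸ 1) * t) - (z + - t) ≡ t * + n
    difference z = begin
      (z + + (n ∸ 1) * t) - (z + - t) ≡⟨ expand z (+ (n ∸ 1)) t ⟩
      + suc (n ∸ 1) * t               ≡⟨ cong (λ c → + c * t) (ℕP.suc-pred n) ⟩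
      + n * t                         ≡⟨ ℤP.*-comm (+ n) t ⟩
      t * + n                         ∎
      where open ≡-Reasoning

  period-∣ : ∀ {s t} → Period P t → t ∣ₛ s → Period P s
  period-∣ pt (divides (+ j) eq) = subst (Period P) (sym eq) (period-*ℕ pt j)
  period-∣ {t = t} pt (divides ℤ.-[1+ j ] eq) =
    subst (Period P) (trans (ℤP.neg-distribˡ-* (+ suc j) t) (sym eq)) (period-neg (period-*ℕ pt (suc j)))

  period-∣ℕ : ∀ {a c} → Period P (+ a) → a ℕD.∣ c → Period P (+ c)
  period-∣ℕ pa a∣c = period-∣ pa (ℤD.∣ᵤ⇒∣ a∣c)

  period-cancel : ∀ {c d} → Period P (+ c) → Period P (+ (d ℕ.+ c)) → Period P (+ d)
  period-cancel {c} {d} pc pdc = subst (Period P) difference (period-+ pdc (period-neg pc))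
    where
    cancel : ∀ x y → (x + y) - y ≡ x
    cancel = solve-∀
    difference : + (d ℕ.+ c) - + c ≡ + d
    difference = trans (cong (_- + c) (ℤP.pos-+ d c)) (cancel (+ d) (+ c))

  period-gcd : ∀ {a b} → Period P (+ a) → Period P (+ b) → Period P (+ gcd a b)
  period-gcd {a} {b} pa pb with Bézout.identity (gcd-GCD a b)
  ... | Bézout.+- x y eq =
    period-cancel (period-∣ℕ pb (ℕD.n∣m*n y)) (subst (Period P ∘ +_) (sym eq) (period-∣ℕ pa (ℕD.n∣m*n x)))
  ... | Bézout.-+ x y eq =
    period-cancel (period-∣ℕ pa (ℕD.n∣m*n x)) (subst (Period P ∘ +_) (sym eq) (period-∣ℕ pb (ℕD.n∣m*n y)))

Representable : ℕ → ∀ {k} → (Fin k → ℤ) → Subset k → ℤ → Set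
Representable n m J z = ∃ λ I → I ⊆ J × + n ∣ₛ subsetSum I m - z

module _ {n k : ℕ} {m : Fin k → ℤ} where

  representable? : ∀ J z → Dec (Representable n m J z)
  representable? J z = anySubset? (λ I → I ⊆? J ×-dec + n ℤD.∣? subsetSum I m - z)

  representable-resp : ∀ {J z z′} → + n ∣ₛ z - z′ → Representable n m J z → Representable n m J z′
  representable-resp {z = z} {z′} n∣z-z′ (I , I⊆J , n∣s-z) =
    I , I⊆J , subst (+ n ∣ₛ_) (telescope (subsetSum I m) z z′) (ℤD.∣m∣n⇒∣m+n n∣s-z n∣z-z′)
    where
    telescope : ∀ s z z′ → (s - z) + (z - z′) ≡ s - z′
    telescope = solve-∀

  representable-mono : ∀ {J J′ z} → J ⊆ J′ → Representable n m J z → Representable n m J′ z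
  representable-mono J⊆J′ (I , I⊆J , n∣) = I , J⊆J′ ∘ I⊆J , n∣

  subsetSum-representable : ∀ {I J} → I ⊆ J → Representable n m J (subsetSum I m)
  subsetSum-representable {I} I⊆J =
    I , I⊆J , divides 0ℤ (trans (ℤP.+-inverseʳ (subsetSum I m)) (sym (ℤP.*-zeroˡ (+ n))))

  representable-∪⁅⁆ : ∀ {J z i} → i ∉ J → Representable n m J z →
                      Representable n m (J ∪ ⁅ i ⁆) (z + m i)
  representable-∪⁅⁆ {J} {z} {i} i∉J (I , I⊆J , n∣) =
    I ∪ ⁅ i ⁆ , ∪-monoˡ-⊆ ⁅ i ⁆ I⊆J , subst (+ n ∣ₛ_) (sym difference) n∣
    where
    cancel : ∀ s x z → (s + x) - (z + x) ≡ s - z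
    cancel = solve-∀
    difference : subsetSum (I ∪ ⁅ i ⁆) m - (z + m i) ≡ subsetSum I m - z
    difference = trans (cong (_- (z + m i)) (subsetSum-∪⁅⁆ I m (i∉J ∘ I⊆J))) (cancel (subsetSum I m) (m i) z)

module _ {n k : ℕ} .{{_ : NonZero n}} {m : Fin k → ℤ} where

  representable-coarsen : ∀ {J g a} → Period (Representable n m J) (+ g) →
                          Representable g m J a → Representable n m J a
  representable-coarsen {J} {a = a} pg (I , I⊆J , g∣s-a) =
    subst (Representable n m J) (cancel (subsetSum I m) a)
      (shift (period-∣ representable-resp pg (∣-diff-comm {x = subsetSum I m} {a} g∣s-a))
             (subsetSum-representable I⊆J))
    where
    cancel : ∀ s a → s + (a - s) ≡ a
    cancel = solve-∀

module Residues {n : ℕ} .{{_ : NonZero n}} {k : ℕ} (m : Fin k → ℤ) where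

  residue : ℤ → Fin n
  residue z = fromℕ< (n%ℕd<d z n)

  residue-congruent : ∀ z → + n ∣ₛ z - + toℕ (residue z)
  residue-congruent z = divides (z /ℕ n) (begin
    z - + toℕ (residue z)                      ≡⟨ cong (λ r → z - + r) (toℕ-fromℕ< (n%ℕd<d z n)) ⟩
    z - + (z %ℕ n)                             ≡⟨ cong (_- + (z %ℕ n)) (a≡a%ℕn+[a/ℕn]*n z n) ⟩
    (+ (z %ℕ n) + (z /ℕ n) * + n) - + (z %ℕ n) ≡⟨ cancel (+ (z %ℕ n)) ((z /ℕ n) * + n) ⟩
    (z /ℕ n) * + n                             ∎)
    where
    open ≡-Reasoning
    cancel : ∀ r x → (r + x) - r ≡ x
    cancel = solve-∀

  residue-congruent′ : ∀ z → + n ∣ₛ + toℕ (residue z) - z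
  residue-congruent′ z = ∣-diff-comm {x = z} {+ toℕ (residue z)} (residue-congruent z)

  representable-at? : ∀ J (r : Fin n) → Dec (Representable n m J (+ toℕ r))
  representable-at? J r = representable? J (+ toℕ r)

  residues : Subset k → Subset n
  residues J = subset (representable-at? J)

  ∈-residues⁺ : ∀ {J z} → Representable n m J z → residue z ∈ residues J
  ∈-residues⁺ {J} {z} z∈ = ∈-subset⁺ (representable-at? J) (representable-resp (residue-congruent z) z∈)

  ∈-residues⁻ : ∀ {J z} → residue z ∈ residues J → Representable n m J z
  ∈-residues⁻ {J} {z} r∈ = representable-resp (residue-congruent′ z) (∈-subset⁻ (representable-at? J) r∈)

  residues-mono : ∀ {J J′} → J ⊆ J′ → residues J ⊆ residues J′
  residues-mono {J} {J′} J⊆J′ r∈ =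
    ∈-subset⁺ (representable-at? J′) (representable-mono J⊆J′ (∈-subset⁻ (representable-at? J) r∈))

  Growing : Subset k → Set
  Growing J = ∣ J ∣ < ∣ residues J ∣

  growing-⊥ : Growing ⊥
  growing-⊥ = subst (_< ∣ residues ⊥ ∣) (trans (∣⊥∣≡0 n) (sym (∣⊥∣≡0 k)))
    (p⊂q⇒∣p∣<∣q∣ (⊥⊆ , residue 0ℤ , ∈-residues⁺ {z = 0ℤ} zero-representable , ∉⊥))
    where
    zero-representable : Representable n m ⊥ 0ℤ
    zero-representable = subst (Representable n m ⊥) (subsetSum-⊥ m) (subsetSum-representable ⊥⊆)

  growing-complete : ∀ {J} → Growing J → n ∸ 1 ≤ ∣ J ∣ → ∀ a → Representable n m J a
  growing-complete {J} growing n-1≤∣J∣ a =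
    ∈-residues⁻ (subst (residue a ∈_) (sym (∣p∣≡n⇒p≡⊤ all-residues)) ∈⊤)
    where
    all-residues : ∣ residues J ∣ ≡ n
    all-residues = ℕP.≤-antisym (∣p∣≤n (residues J))
      (subst (_≤ ∣ residues J ∣) (ℕP.suc-pred n) (ℕP.≤-trans (s≤s n-1≤∣J∣) growing))

module Saturation {n : ℕ} .{{_ : NonZero n}} {k : ℕ} (m : Fin k → ℤ) (J₀ : Subset k) where
  open Residues m

  Saturated : Subset k → Set
  Saturated J = ∀ {i} → i ∈ J₀ ∩ ∁ J → Period (Representable n m J) (m i)

  Enlarges : Subset k → Fin k → Set
  Enlarges J i = i ∈ J₀ ∩ ∁ J ×
                 ∃ λ (r : Fin n) → Representable n m J (+ toℕ r) × ¬ Representable n m J (+ toℕ r + m i)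

  enlarges? : ∀ J → Decidable (Enlarges J)
  enlarges? J i = (i ∈? J₀ ∩ ∁ J) ×-dec
                  any? (λ r → representable-at? J r ×-dec ¬? (representable? {n} J (+ toℕ r + m i)))

  enlarge-growing : ∀ {J i} → Enlarges J i → Growing J → Growing (J ∪ ⁅ i ⁆)
  enlarge-growing {J} {i} (i∈J₀∖J , r , r∈ , r+mi∉) growing = begin-strict
    ∣ J ∪ ⁅ i ⁆ ∣             ≡⟨ ∣p∪⁅x⁆∣≡1+∣p∣ J i∉J ⟩
    suc ∣ J ∣                 ≤⟨ growing ⟩
    ∣ residues J ∣            <⟨ p⊂q⇒∣p∣<∣q∣ (residues-mono (p⊆p∪q ⁅ i ⁆) , residue z , z∈ , z∉) ⟩
    ∣ residues (J ∪ ⁅ i ⁆) ∣  ∎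
    where
    open ℕP.≤-Reasoning
    i∉J : i ∉ J
    i∉J = proj₂ (x∈p∩∁q⁻ J₀ J i∈J₀∖J)
    z : ℤ
    z = + toℕ r + m i
    z∈ : residue z ∈ residues (J ∪ ⁅ i ⁆)
    z∈ = ∈-residues⁺ (representable-∪⁅⁆ i∉J r∈)
    z∉ : residue z ∉ residues J
    z∉ = r+mi∉ ∘ ∈-residues⁻

  no-enlargement⇒saturated : ∀ {J} → ¬ ∃ (Enlarges J) → Saturated J
  no-enlargement⇒saturated {J} ¬enlarges {i} i∈J₀∖J = period λ {z} z∈ →
    let r = residue z
        r∈ = representable-resp (residue-congruent z) z∈
        r+mi∈ = decidable-stable (representable? {n} J (+ toℕ r + m i))
                  (λ r+mi∉ → ¬enlarges (i , i∈J₀∖J , r , r∈ , r+mi∉))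
    in representable-resp (shift-congruent (+ toℕ r) z (residue-congruent′ z)) r+mi∈
    where
    cancel : ∀ x y c → (x + c) - (y + c) ≡ x - y
    cancel = solve-∀
    shift-congruent : ∀ x y → + n ∣ₛ x - y → + n ∣ₛ (x + m i) - (y + m i)
    shift-congruent x y = subst (+ n ∣ₛ_) (sym (cancel x y (m i)))

  -- Each enlargement adds an index, so the fuel f only has to cover k - ∣ J ∣ steps.
  saturate : ∀ f J → J ⊆ J₀ → Growing J → k ≤ ∣ J ∣ ℕ.+ f →
             ∃ λ J′ → J′ ⊆ J₀ × Growing J′ × Saturated J′
  saturate f J J⊆J₀ growing k≤ with any? (enlarges? J)
  ... | no ¬enlarges = J , J⊆J₀ , growing , no-enlargement⇒saturated ¬enlarges
  ... | yes (i , enlarges) with x∈p∩∁q⁻ J₀ J (proj₁ enlarges) | f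
  ...   | _ , i∉J | zero =
    contradiction (subst (k ≤_) (ℕP.+-identityʳ ∣ J ∣) k≤) (ℕP.<⇒≱ (x∉p⇒∣p∣<n J i∉J))
  ...   | i∈J₀ , i∉J | suc f =
    saturate f (J ∪ ⁅ i ⁆) (∪⁅⁆-⊆ J⊆J₀ i∈J₀) (enlarge-growing enlarges growing)
      (subst (k ≤_) (trans (ℕP.+-suc ∣ J ∣ f) (cong (ℕ._+ f) (sym (∣p∪⁅x⁆∣≡1+∣p∣ J i∉J)))) k≤)

nonDivisors : ∀ {k} → ℕ → (Fin k → ℤ) → Subset k
nonDivisors d m = subset (λ s → ¬? (d ℕD.∣? ℤ.∣ m s ∣))

nonDivCount≡∣⊤∩nonDivisors∣ : ∀ {k} d (m : Fin k → ℤ) → nonDivCount d m ≡ ∣ ⊤ ∩ nonDivisors d m ∣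
nonDivCount≡∣⊤∩nonDivisors∣ d m =
  trans (length-filter-tabulate (λ s → ¬? (d ℕD.∣? ℤ.∣ m s ∣)) id)
        (cong ∣_∣ (sym (∩-identityˡ (nonDivisors d m))))

NonDivisorBound : ℕ → ∀ {k} → (Fin k → ℤ) → Subset k → Set
NonDivisorBound n m J = ∀ d → 0 < d → d ℕD.∣ n → d ∸ 1 ≤ ∣ J ∩ nonDivisors d m ∣

SubsetSumsComplete : ℕ → Set
SubsetSumsComplete n = ∀ {k} (m : Fin k → ℤ) (J : Subset k) →
                       NonDivisorBound n m J → ∀ a → Representable n m J a

module InductionStep {n : ℕ} .{{_ : NonZero n}}
                     (complete-below : ∀ g → 0 < g → g < n → SubsetSumsComplete g)
                     {k : ℕ} (m : Fin k → ℤ) (J₀ : Subset k) (bound : NonDivisorBound n m J₀) where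
  open Residues m
  open Saturation m J₀

  module _ {J : Subset k} (saturated : Saturated J) where

    unusedGcd : ℕ
    unusedGcd = gcdOver (J₀ ∩ ∁ J) (ℤ.∣_∣ ∘ m) n

    unusedGcd∣n : unusedGcd ℕD.∣ n
    unusedGcd∣n = gcdOver∣base (J₀ ∩ ∁ J) (ℤ.∣_∣ ∘ m) n

    unusedGcd-period : Period (Representable n m J) (+ unusedGcd)
    unusedGcd-period = gcdOver-closed (Period (Representable n m J) ∘ +_) (period-gcd representable-resp)
      (J₀ ∩ ∁ J) (ℤ.∣_∣ ∘ m) (λ i∈ → period-∣ representable-resp (saturated i∈) ℤD.m∣∣m∣)
      (period-n representable-resp)

    nonDivisors-inherited : ∀ {d} → d ℕD.∣ unusedGcd → ∣ J₀ ∩ nonDivisors d m ∣ ≤ ∣ J ∩ nonDivisors d m ∣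
    nonDivisors-inherited {d} d∣g = ∣p∩r∣≤∣q∩r∣ J₀ J (nonDivisors d m) λ i∈ i∈nonDivisors →
      ∈-subset⁻ (λ s → ¬? (d ℕD.∣? ℤ.∣ m s ∣)) i∈nonDivisors
        (ℕD.∣-trans d∣g (gcdOver∣elem (J₀ ∩ ∁ J) (ℤ.∣_∣ ∘ m) n i∈))

    saturated-complete : J ⊆ J₀ → Growing J → ∀ a → Representable n m J₀ a
    saturated-complete J⊆J₀ growing a with unusedGcd ℕ.<? n
    ... | yes g<n = representable-mono J⊆J₀
      (representable-coarsen unusedGcd-period (complete-below unusedGcd 0<g g<n m J bound-inherited a))
      where
      0<g : 0 < unusedGcd
      0<g = ℕP.n≢0⇒n>0 λ g≡0 → ℕ.≢-nonZero⁻¹ n (ℕD.0∣⇒≡0 (subst (ℕD._∣ n) g≡0 unusedGcd∣n))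
      bound-inherited : NonDivisorBound unusedGcd m J
      bound-inherited d 0<d d∣g =
        ℕP.≤-trans (bound d 0<d (ℕD.∣-trans d∣g unusedGcd∣n)) (nonDivisors-inherited d∣g)
    ... | no g≮n = representable-mono J⊆J₀ (growing-complete growing n-1≤∣J∣ a)
      where
      n∣g : n ℕD.∣ unusedGcd
      n∣g = ℕD.∣-reflexive (ℕP.≤-antisym (ℕP.≮⇒≥ g≮n) (ℕD.∣⇒≤ unusedGcd∣n))
      n-1≤∣J∣ : n ∸ 1 ≤ ∣ J ∣
      n-1≤∣J∣ = begin
        n ∸ 1                     ≤⟨ bound n (ℕ.>-nonZero⁻¹ n) ℕD.∣-refl ⟩
        ∣ J₀ ∩ nonDivisors n m ∣  ≤⟨ nonDivisors-inherited n∣g ⟩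
        ∣ J ∩ nonDivisors n m ∣   ≤⟨ ∣p∩q∣≤∣p∣ J (nonDivisors n m) ⟩
        ∣ J ∣                     ∎
        where open ℕP.≤-Reasoning

subsetSums-complete : ∀ n → 0 < n → SubsetSumsComplete n
subsetSums-complete = <-rec _ step
  where
  step : ∀ n → (∀ {g} → g < n → 0 < g → SubsetSumsComplete g) → 0 < n → SubsetSumsComplete n
  step n complete-below 0<n {k} m J₀ bound =
    let J , J⊆J₀ , growing , saturated =
          Saturation.saturate {n} m J₀ k ⊥ ⊥⊆ (Residues.growing-⊥ {n} m) (ℕP.m≤n+m k ∣ ⊥ {k} ∣)
    in InductionStep.saturated-complete {n} (λ g 0<g g<n → complete-below g<n 0<g)
         m J₀ bound saturated J⊆J₀ growing
    where
    instance
      n≢0 : NonZero n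
      n≢0 = ℕ.>-nonZero 0<n

theorem1p2 : (n : ℕ) → 1 < n → (m : Fin (n ∸ 1) → ℤ) →
             (∀ (d : ℕ) → 0 < d → d ℕD.∣ n → nonDivCount d m ≥ d ∸ 1) →
             ∀ (a : ℤ) → ∃ λ (I : Vec Bool (n ∸ 1)) → (+ n) ∣ (subsetSum I m - a)
theorem1p2 n 1<n m hyp a =
  map₂ (ℤD.∣⇒∣ᵤ ∘ proj₂) (subsetSums-complete n (ℕP.<-trans ℕ.z<s 1<n) m ⊤ bound a)
  where
  bound : NonDivisorBound n m ⊤
  bound d 0<d d∣n = subst (d ∸ 1 ≤_) (nonDivCount≡∣⊤∩nonDivisors∣ d m) (hyp d 0<d d∣n)
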